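{- Let $G$ be a loopless multigraph of maximum degree $\Delta\ge 2$, let $\phi$ be a proper partial $\lfloor 3\Delta/2\rfloor$-edge-coloring of $G$, let $e$ be an uncolored edge and $x\in V(e)$. Let $(F,\alpha,\beta)$ be the output of the First Shannon Fan procedure on input $(\phi,e,x)$. Then no edge in $F$ is colored $\alpha$ or $\beta$ under $\phi$, and at least one of the following holds: (i) $\beta\in M(\phi,x)$ and $F$ is $\phi$-happy; (ii) $F$ has length $2$ and $F$ is $(\phi,\alpha\beta)$-successful; (iii) $e$ is $(\phi,\alpha\beta)$-successful.
   Context: Colors are $[r]=\{1,\dots,r\}$ with $r=\lfloor 3\Delta/2\rfloor$, ordered as integers. A partial $r$-edge-coloring is $\phi:E(G)\to[r]\cup\{\mathsf{blank}\}$ (uncolored edges map to $\mathsf{blank}$); it is proper if distinct colored edges sharing an endpoint get distinct colors. $M(\phi,v)$ is the set of colors in $[r]$ not used on edges at $v$. A chain is a sequence $(e_0,\dots,e_{k-1})$ of distinct edges with $|V(e_i)\cap V(e_{i+1})|=1$; $\mathsf{End}$ is its last edge; $\mathsf{Shift}(\phi,C)$ gives $e_i$ the color $\phi(e_{i+1})$ for $i<k-1$, uncolors $e_{k-1}$, and keeps other edges. $C$ is $\phi$-shiftable if $\phi(e_0)=\mathsf{blank}$ and $\mathsf{Shift}(\phi,C)$ is proper; an uncolored edge with endpoints $u,v$ is $\phi$-happy if $M(\phi,u)\cap M(\phi,v)\ne\varnothing$; $C$ is $\phi$-happy if it is $\phi$-shiftable and $\mathsf{End}(C)$ is $\mathsf{Shift}(\phi,C)$-happy.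 $G(\phi,\alpha\beta)$ is the spanning subgraph of edges colored $\alpha$ or $\beta$; $\deg(v;\phi,\alpha\beta)$ is the degree there; $u,v$ are $(\phi,\alpha\beta)$-related if in the same component of $G(\phi,\alpha\beta)$. An uncolored edge with endpoints $u,v$ is $(\phi,\alpha\beta)$-successful if $\deg(u;\phi,\alpha\beta)<2$, $\deg(v;\phi,\alpha\beta)<2$ and $u,v$ are not $(\phi,\alpha\beta)$-related. A fan is a chain whose edges share a common vertex, the pivot; $\mathsf{vEnd}(F)$ is the endpoint of the last edge other than the pivot. A $\phi$-shiftable fan $F$ that is not $\phi$-happy, with pivot $x$ and $y=\mathsf{vEnd}(F)$, is $(\phi,\alpha\beta)$-successful if $\deg(x;\phi,\alpha\beta)<2$, $\deg(y;\phi,\alpha\beta)<2$ and $x,y$ are not $(\mathsf{Shift}(\phi,F),\alpha\beta)$-related. First Shannon Fan procedure on $(\phi,e,x)$: let $y$ be the endpoint of $e$ other than $x$. If $M(\phi,x)\cap M(\phi,y)\ne\varnothing$, let $\beta$ be its minimum and return $((e),\beta,\beta)$. Otherwise let $\eta=\min M(\phi,y)$, let $f$ be the edge at $x$ with $\phi(f)=\eta$, and $z$ the endpoint of $f$ other than $x$. If $M(\phi,x)\cap M(\phi,z)\neq\varnothing$, let $\beta$ be its minimum and return $((e,f),\beta,\beta)$. Otherwise let $\beta=\min M(\phi,y)\cap M(\phi,z)$, $\alpha=\min M(\phi,x)$, and return $((e,f),\alpha,\beta)$. In each case the fan has pivot $x$. -}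

module Defs where

open import Data.Nat using (ℕ; zero; suc; _≤_; _<_; _*_)
open import Data.Nat.DivMod using (_/_)
open import Data.Fin using (Fin)
open import Data.Fin.Properties using () renaming (_≟_ to _≟ᶠ_)
open import Data.Nat.Properties using () renaming (_≟_ to _≟ⁿ_)
open import Data.Maybe using (Maybe; just; nothing)
open import Data.Bool using (Bool; true; false; _∨_; if_then_else_)
open import Data.List using (List; []; _∷_; filter; allFin)
import Data.List as L
open import Data.List.NonEmpty using (List⁺; _∷_; toList; last)
open import Data.List.Relation.Unary.All using (All)
open import Data.List.Relation.Unary.Unique.Propositional using (Unique)
open import Data.Product using (Σ; ∃; ∃-syntax; _×_; _,_; proj₁; proj₂)
open import Data.Sum using (_⊎_)
open import Data.Empty using (⊥)
open import Data.Unit using (⊤)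
open import Relation.Nullary using (¬_; Dec; yes; no; does)
open import Relation.Nullary.Decidable using (_⊎-dec_)
open import Relation.Binary.PropositionalEquality using (_≡_; _≢_)

-- Loopless multigraphs: vertices Fin V, edges Fin E (parallel edges allowed),
-- each edge has an (ordered, for bookkeeping only) pair of distinct endpoints.

record Multigraph : Set where
  field
    V        : ℕ
    E        : ℕ
    ends     : Fin E → Fin V × Fin V
    loopless : ∀ e → proj₁ (ends e) ≢ proj₂ (ends e)

open Multigraph public

Vtx : Multigraph → Set
Vtx G = Fin (V G)

Edge : Multigraph → Set
Edge G = Fin (E G)

Incident : (G : Multigraph) → Vtx G → Edge G → Set
Incident G v e = proj₁ (ends G e) ≡ v ⊎ proj₂ (ends G e) ≡ v

incident? : (G : Multigraph) → (v : Vtx G) → (e : Edge G) → Dec (Incident G v e)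
incident? G v e = (proj₁ (ends G e) ≟ᶠ v) ⊎-dec (proj₂ (ends G e) ≟ᶠ v)

Joins : (G : Multigraph) → Edge G → Vtx G → Vtx G → Set
Joins G e x y = ends G e ≡ (x , y) ⊎ ends G e ≡ (y , x)

-- degree (number of incident edges; loopless so each counts once)
deg : (G : Multigraph) → Vtx G → ℕ
deg G v = L.length (filter (incident? G v) (allFin (E G)))

MaxDegree : Multigraph → ℕ → Set
MaxDegree G Δ = (∀ v → deg G v ≤ Δ) × (∃[ v ] deg G v ≡ Δ)

-- Partial edge colorings. Colours are natural numbers; `nothing` = blank.

Coloring : Multigraph → Set
Coloring G = Edge G → Maybe ℕ

PartialColoring : (G : Multigraph) → ℕ → Coloring G → Set
PartialColoring G r φ = ∀ e c → φ e ≡ just c → 1 ≤ c × c ≤ r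

Proper : (G : Multigraph) → Coloring G → Set
Proper G φ = ∀ e f v c → e ≢ f → Incident G v e → Incident G v f →
             φ e ≡ just c → φ f ≡ just c → ⊥

Missing : (G : Multigraph) → ℕ → Coloring G → Vtx G → ℕ → Set
Missing G r φ v c = (1 ≤ c × c ≤ r) × (∀ e → Incident G v e → φ e ≢ just c)

IsMin : (ℕ → Set) → ℕ → Set
IsMin P c = P c × (∀ d → P d → c ≤ d)

ShareOne : (G : Multigraph) → Edge G → Edge G → Set
ShareOne G e f = ∃[ v ] (Incident G v e × Incident G v f ×
                         (∀ w → Incident G w e → Incident G w f → w ≡ v))

Consecutive : (G : Multigraph) → List (Edge G) → Set
Consecutive G []           = ⊤
Consecutive G (e ∷ [])     = ⊤
Consecutive G (e ∷ f ∷ es) = ShareOne G e f × Consecutive G (f ∷ es)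

Chain : (G : Multigraph) → List⁺ (Edge G) → Set
Chain G C = Unique (toList C) × Consecutive G (toList C)

End : {G : Multigraph} → List⁺ (Edge G) → Edge G
End = last

shiftL : (G : Multigraph) → Coloring G → List (Edge G) → Coloring G
shiftL G φ []           g = φ g
shiftL G φ (e ∷ [])     g = if does (g ≟ᶠ e) then nothing else φ g
shiftL G φ (e ∷ f ∷ es) g = if does (g ≟ᶠ e) then φ f else shiftL G φ (f ∷ es) g

Shift : (G : Multigraph) → Coloring G → List⁺ (Edge G) → Coloring G
Shift G φ C = shiftL G φ (toList C)

Shiftable : (G : Multigraph) → Coloring G → List⁺ (Edge G) → Set
Shiftable G φ C = Chain G C × φ (Data.List.NonEmpty.head C) ≡ nothing × Proper G (Shift G φ C)

HappyEdge : (G : Multigraph) → ℕ → Coloring G → Edge G → Set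
HappyEdge G r φ e = φ e ≡ nothing ×
  ∃[ c ] (Missing G r φ (proj₁ (ends G e)) c × Missing G r φ (proj₂ (ends G e)) c)

Happy : (G : Multigraph) → ℕ → Coloring G → List⁺ (Edge G) → Set
Happy G r φ C = Shiftable G φ C × HappyEdge G r (Shift G φ C) (End {G} C)

isAB : Maybe ℕ → ℕ → ℕ → Bool
isAB nothing  α β = false
isAB (just c) α β = does (c ≟ⁿ α) ∨ does (c ≟ⁿ β)

ColAB : (G : Multigraph) → Coloring G → ℕ → ℕ → Edge G → Set
ColAB G φ α β e = isAB (φ e) α β ≡ true

degAB : (G : Multigraph) → Coloring G → ℕ → ℕ → Vtx G → ℕ
degAB G φ α β v =
  L.length (filter (λ e → incident? G v e) (filter (λ e → isAB (φ e) α β Data.Bool.≟ true) (allFin (E G))))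

data Related (G : Multigraph) (φ : Coloring G) (α β : ℕ) (u : Vtx G) : Vtx G → Set where
  here : Related G φ α β u u
  step : ∀ {w v} e → Related G φ α β u w → ColAB G φ α β e → Joins G e w v →
         Related G φ α β u v

SuccessfulEdge : (G : Multigraph) → Coloring G → ℕ → ℕ → Edge G → Set
SuccessfulEdge G φ α β e =
  φ e ≡ nothing ×
  degAB G φ α β (proj₁ (ends G e)) < 2 × degAB G φ α β (proj₂ (ends G e)) < 2 ×
  ¬ Related G φ α β (proj₁ (ends G e)) (proj₂ (ends G e))

Fan : (G : Multigraph) → Vtx G → List⁺ (Edge G) → Set
Fan G x F = Chain G F × All (Incident G x) (toList F)

other : (G : Multigraph) → Vtx G → Edge G → Vtx G
other G x e = if does (proj₁ (ends G e) ≟ᶠ x) then proj₂ (ends G e) else proj₁ (ends G e)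

vEnd : (G : Multigraph) → Vtx G → List⁺ (Edge G) → Vtx G
vEnd G x F = other G x (End {G} F)

SuccessfulFan : (G : Multigraph) → ℕ → Coloring G → ℕ → ℕ → Vtx G → List⁺ (Edge G) → Set
SuccessfulFan G r φ α β x F =
  Fan G x F × Shiftable G φ F × ¬ Happy G r φ F ×
  degAB G φ α β x < 2 × degAB G φ α β (vEnd G x F) < 2 ×
  ¬ Related G (Shift G φ F) α β x (vEnd G x F)

-- First Shannon Fan procedure, as a relation  FirstShannonFan … φ e x F α β
-- meaning "(F, α, β) is the output of the procedure on input (φ, e, x)".

FirstShannonFan : (G : Multigraph) → ℕ → Coloring G → Edge G → Vtx G →
                  List⁺ (Edge G) → ℕ → ℕ → Set
FirstShannonFan G r φ e x F α β =
  (∃[ y ] (Joins G e x y × IsMin (λ c → M x c × M y c) β ×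
           F ≡ e ∷ [] × α ≡ β))
  ⊎
  (∃[ y ] ∃[ η ] ∃[ f ] ∃[ z ]
     (Joins G e x y × (∀ c → ¬ (M x c × M y c)) × IsMin (M y) η ×
      φ f ≡ just η × Joins G f x z ×
      IsMin (λ c → M x c × M z c) β ×
      F ≡ e ∷ f ∷ [] × α ≡ β))
  ⊎
  (∃[ y ] ∃[ η ] ∃[ f ] ∃[ z ]
     (Joins G e x y × (∀ c → ¬ (M x c × M y c)) × IsMin (M y) η ×
      φ f ≡ just η × Joins G f x z ×
      (∀ c → ¬ (M x c × M z c)) ×
      IsMin (λ c → M y c × M z c) β × IsMin (M x) α ×
      F ≡ e ∷ f ∷ []))
  where
    M : Vtx G → ℕ → Set
    M = Missing G r φ

colors : ℕ → ℕ
colors Δ = (3 * Δ) / 2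

-- In the first two outputs of the procedure, β is missing at both ends of the last fan edge
-- (and differs from the shifted colour), so the fan is happy. In the third case α is missing
-- at x and β at y and z, so these three vertices have degree at most 1 in the subgraph of
-- colours α and β, which has maximum degree 2; hence the component of x is a path with x as an
-- end and contains at most one of y, z. If it misses y the edge e is successful; otherwise it
-- misses z, and since shifting the fan only moves the colour η ∉ {α, β}, the fan is successful.
module Submission where

open import Defs
open import Data.Nat using (ℕ; _≤_; _<_; z≤n; s≤s)
open import Data.Nat.Induction using (<-wellFounded)
open import Data.Nat.Properties using () renaming (_≟_ to _≟ⁿ_)
open import Data.Maybe using (just; nothing)
open import Data.Maybe.Properties using (just-injective)
open import Data.Bool using (true; false; _∨_)
import Data.Bool as Bool
open import Data.Fin using (Fin; zero; suc)
open import Data.Fin.Properties using (any?) renaming (_≟_ to _≟ᶠ_)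
open import Data.Fin.Subset using (Subset; _∈_; _∉_; _⊆_; _-_; ∣_∣; ⁅_⁆)
open import Data.Fin.Subset.Properties using (_∈?_; x∈p⇒∣p-x∣<∣p∣; x∈p∧x≢y⇒x∈p-y; p─q⊆p)
open import Data.Vec using (_∷_; tabulate; there)
open import Data.Vec.Properties using (lookup∘tabulate; []=⇒lookup; lookup⇒[]=)
open import Data.List using (List; []; _∷_; filter; allFin)
import Data.List as List
open import Data.List.NonEmpty using (List⁺; _∷_; toList; length)
open import Data.List.Relation.Unary.All using (All; []; _∷_)
import Data.List.Relation.Unary.All as All
import Data.List.Relation.Unary.All.Properties as All
open import Data.List.Relation.Unary.AllPairs using ([]; _∷_)
open import Data.List.Relation.Unary.Unique.Propositional using (Unique)
import Data.List.Relation.Unary.Unique.Propositional.Properties as Unique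
open import Data.Product using (∃-syntax; _×_; _,_; proj₁; proj₂; swap)
open import Data.Sum using (_⊎_; inj₁; inj₂; [_,_])
open import Data.Empty using (⊥-elim)
open import Data.Unit using (tt)
open import Function using (id; _∘_; case_of_)
open import Induction.WellFounded using (Acc; acc)
open import Relation.Binary using (Symmetric)
open import Relation.Nullary using (¬_; Dec; yes; no; does)
open import Relation.Nullary.Decidable using (_×-dec_; dec-false)
open import Relation.Binary.PropositionalEquality hiding ([_])

Unique⇒length<2 : ∀ {A : Set} {P : A → Set} (xs : List A) → Unique xs → All P xs →
                  (∀ {a b} → P a → P b → a ≡ b) → List.length xs < 2
Unique⇒length<2 []          _               _             _     = s≤s z≤n
Unique⇒length<2 (_ ∷ [])    _               _             _     = s≤s (s≤s z≤n)
Unique⇒length<2 (_ ∷ _ ∷ _) ((a≢b ∷ _) ∷ _) (pa ∷ pb ∷ _) equal = ⊥-elim (a≢b (equal pa pb))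

x∉p-x : ∀ {n} (p : Subset n) (x : Fin n) → x ∉ p - x
x∉p-x (_ ∷ p) zero    ()
x∉p-x (_ ∷ p) (suc x) (there x∈p-x) = x∉p-x p x x∈p-x

x∈p-y⇒x≢y : ∀ {n} {p : Subset n} {x y} → x ∈ p - y → x ≢ y
x∈p-y⇒x≢y {p = p} x∈p-y refl = x∉p-x p _ x∈p-y

isAB-≢ : ∀ {c α β} → c ≢ α → c ≢ β → isAB (just c) α β ≡ false
isAB-≢ {c} {α} {β} c≢α c≢β = cong₂ _∨_ (dec-false (c ≟ⁿ α) c≢α) (dec-false (c ≟ⁿ β) c≢β)

isAB⇒≡α⊎≡β : ∀ {m α β} → isAB m α β ≡ true → m ≡ just α ⊎ m ≡ just β
isAB⇒≡α⊎≡β {just c} {α} {β} p with c ≟ⁿ α | c ≟ⁿ β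
... | yes c≡α | _       = inj₁ (cong just c≡α)
... | no _    | yes c≡β = inj₂ (cong just c≡β)
... | no c≢α  | no c≢β  = case trans (sym (isAB-≢ c≢α c≢β)) p of λ ()

module _ (G : Multigraph) where

  Joins⇒incidentˡ : ∀ {g a b} → Joins G g a b → Incident G a g
  Joins⇒incidentˡ (inj₁ eq) = inj₁ (cong proj₁ eq)
  Joins⇒incidentˡ (inj₂ eq) = inj₂ (cong proj₂ eq)

  Joins⇒incidentʳ : ∀ {g a b} → Joins G g a b → Incident G b g
  Joins⇒incidentʳ (inj₁ eq) = inj₂ (cong proj₂ eq)
  Joins⇒incidentʳ (inj₂ eq) = inj₁ (cong proj₁ eq)

  Joins-sym : ∀ {g a b} → Joins G g a b → Joins G g b a
  Joins-sym = Data.Sum.swap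

  Joins-incident : ∀ {g a b v} → Joins G g a b → Incident G v g → v ≡ a ⊎ v ≡ b
  Joins-incident (inj₁ eq) (inj₁ p₁≡v) = inj₁ (trans (sym p₁≡v) (cong proj₁ eq))
  Joins-incident (inj₁ eq) (inj₂ p₂≡v) = inj₂ (trans (sym p₂≡v) (cong proj₂ eq))
  Joins-incident (inj₂ eq) (inj₁ p₁≡v) = inj₂ (trans (sym p₁≡v) (cong proj₁ eq))
  Joins-incident (inj₂ eq) (inj₂ p₂≡v) = inj₁ (trans (sym p₂≡v) (cong proj₂ eq))

  Joins⇒≢ : ∀ {g a b} → Joins G g a b → a ≢ b
  Joins⇒≢ {g} (inj₁ eq) refl = loopless G g (trans (cong proj₁ eq) (sym (cong proj₂ eq)))
  Joins⇒≢ {g} (inj₂ eq) refl = loopless G g (trans (cong proj₁ eq) (sym (cong proj₂ eq)))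

  Joins-other : ∀ {g a} → Incident G a g → Joins G g a (other G a g)
  Joins-other {g} {a} a∈g = joins (proj₁ (ends G g) ≟ᶠ a)
    where
    joins : (d : Dec (proj₁ (ends G g) ≡ a)) →
            Joins G g a (Bool.if does d then proj₂ (ends G g) else proj₁ (ends G g))
    joins (yes p₁≡a) = inj₁ (cong (_, proj₂ (ends G g)) p₁≡a)
    joins (no p₁≢a)  = inj₂ (cong (proj₁ (ends G g) ,_) ([ ⊥-elim ∘ p₁≢a , id ] a∈g))

  other-Joins : ∀ {g a b} → Joins G g a b → other G a g ≡ b
  other-Joins j with Joins-other (Joins⇒incidentˡ j)
  ... | j′ with Joins-incident j (Joins⇒incidentʳ j′)
  ...   | inj₁ other≡a = ⊥-elim (Joins⇒≢ j′ (sym other≡a))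
  ...   | inj₂ other≡b = other≡b

  onEnds : ∀ {g a b} {R : Vtx G → Vtx G → Set} → Symmetric R → Joins G g a b →
           R a b → R (proj₁ (ends G g)) (proj₂ (ends G g))
  onEnds R-sym (inj₁ eq) Rab rewrite eq = Rab
  onEnds R-sym (inj₂ eq) Rab rewrite eq = R-sym Rab

  fromEnds : ∀ {g a b} {R : Vtx G → Vtx G → Set} → Symmetric R → Joins G g a b →
             R (proj₁ (ends G g)) (proj₂ (ends G g)) → R a b
  fromEnds R-sym (inj₁ eq) R-ends rewrite eq = R-ends
  fromEnds R-sym (inj₂ eq) R-ends rewrite eq = R-sym R-ends

  data Connected (H : Subset (E G)) (u : Vtx G) : Vtx G → Set where
    here : Connected H u u
    step : ∀ {w v g} → Connected H u w → g ∈ H → Joins G g w v → Connected H u v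

  module _ {H : Subset (E G)} where

    Connected-trans : ∀ {a b c} → Connected H a b → Connected H b c → Connected H a c
    Connected-trans a~b here             = a~b
    Connected-trans a~b (step b~w g∈H j) = step (Connected-trans a~b b~w) g∈H j

    Connected-sym : ∀ {a b} → Connected H a b → Connected H b a
    Connected-sym here             = here
    Connected-sym (step a~w g∈H j) = Connected-trans (step here g∈H (Joins-sym j)) (Connected-sym a~w)

    Connected-mono : ∀ {H′ a b} → H ⊆ H′ → Connected H a b → Connected H′ a b
    Connected-mono H⊆H′ here             = here
    Connected-mono H⊆H′ (step a~w g∈H j) = step (Connected-mono H⊆H′ a~w) (H⊆H′ g∈H) j

  Isolated : Subset (E G) → Vtx G → Set
  Isolated H v = ∀ {g} → g ∈ H → ¬ Incident G v g

  Degree≤1 : Subset (E G) → Vtx G → Set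
  Degree≤1 H v = ∀ {g h} → g ∈ H → h ∈ H → Incident G v g → Incident G v h → g ≡ h

  MaxDegree≤2 : Subset (E G) → Set
  MaxDegree≤2 H = ∀ {v g h k} → g ∈ H → h ∈ H → k ∈ H →
                  Incident G v g → Incident G v h → Incident G v k → g ≡ h ⊎ g ≡ k ⊎ h ≡ k

  Degree≤1-mono : ∀ {H H′ v} → H′ ⊆ H → Degree≤1 H v → Degree≤1 H′ v
  Degree≤1-mono H′⊆H v₁ g∈H′ h∈H′ = v₁ (H′⊆H g∈H′) (H′⊆H h∈H′)

  MaxDegree≤2-mono : ∀ {H H′} → H′ ⊆ H → MaxDegree≤2 H → MaxDegree≤2 H′
  MaxDegree≤2-mono H′⊆H Δ₂ g∈H′ h∈H′ k∈H′ = Δ₂ (H′⊆H g∈H′) (H′⊆H h∈H′) (H′⊆H k∈H′)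

  module _ {H : Subset (E G)} {g : Edge G} where

    H-g⊆H : H - g ⊆ H
    H-g⊆H = p─q⊆p H ⁅ g ⁆

    Degree≤1-after-removal : ∀ {w} → MaxDegree≤2 H → g ∈ H → Incident G w g → Degree≤1 (H - g) w
    Degree≤1-after-removal Δ₂ g∈H w∈g h∈ k∈ w∈h w∈k
      with Δ₂ g∈H (H-g⊆H h∈) (H-g⊆H k∈) w∈g w∈h w∈k
    ... | inj₁ g≡h        = ⊥-elim (x∈p-y⇒x≢y h∈ (sym g≡h))
    ... | inj₂ (inj₁ g≡k) = ⊥-elim (x∈p-y⇒x≢y k∈ (sym g≡k))
    ... | inj₂ (inj₂ h≡k) = h≡k

    Isolated-after-removal : ∀ {w} → Degree≤1 H w → g ∈ H → Incident G w g → Isolated (H - g) w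
    Isolated-after-removal w₁ g∈H w∈g h∈ w∈h = x∈p-y⇒x≢y h∈ (w₁ (H-g⊆H h∈) g∈H w∈h w∈g)

  Isolated-connected : ∀ {H a v} → Isolated H a → Connected H a v → v ≡ a
  Isolated-connected iso here = refl
  Isolated-connected iso (step a~w g∈H j) with Isolated-connected iso a~w
  ... | refl = ⊥-elim (iso g∈H (Joins⇒incidentˡ j))

  Connected-through-pendant : ∀ {H a g w v} → Degree≤1 H a → g ∈ H → Joins G g a w →
                              Connected H a v → v ≡ a ⊎ Connected (H - g) w v
  Connected-through-pendant a₁ g∈H jg here = inj₁ refl
  Connected-through-pendant {g = g} a₁ g∈H jg (step {g = h} a~u h∈H jh) with h ≟ᶠ g
  ... | yes refl = Data.Sum.map₂ (λ { refl → here }) (Joins-incident jg (Joins⇒incidentʳ jh))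
  ... | no h≢g with Connected-through-pendant a₁ g∈H jg a~u
  ...   | inj₁ refl = ⊥-elim (h≢g (a₁ h∈H g∈H (Joins⇒incidentˡ jh) (Joins⇒incidentˡ jg)))
  ...   | inj₂ w~u  = inj₂ (step w~u (x∈p∧x≢y⇒x∈p-y h∈H h≢g) jh)

  OtherEnd : Subset (E G) → Vtx G → Vtx G → Set
  OtherEnd H a t = Connected H a t × (∀ {v} → Connected H a v → Degree≤1 H v → v ≡ a ⊎ v ≡ t)

  Isolated⇒OtherEnd : ∀ {H a} → Isolated H a → OtherEnd H a a
  Isolated⇒OtherEnd iso = here , λ a~v _ → inj₁ (Isolated-connected iso a~v)

  OtherEnd-extend : ∀ {H a g w t} → Degree≤1 H a → g ∈ H → Joins G g a w →
                    OtherEnd (H - g) w t → OtherEnd H a t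
  OtherEnd-extend {H} {a} {g} {w} {t} a₁ g∈H jg (w~t , ends) =
    Connected-trans (step here g∈H jg) (Connected-mono H-g⊆H w~t) , is-end
    where
    is-end : ∀ {v} → Connected H a v → Degree≤1 H v → v ≡ a ⊎ v ≡ t
    is-end a~v v₁ with Connected-through-pendant a₁ g∈H jg a~v
    ... | inj₁ v≡a = inj₁ v≡a
    ... | inj₂ w~v with ends w~v (Degree≤1-mono H-g⊆H v₁)
    ...   | inj₂ v≡t  = inj₂ v≡t
    ...   | inj₁ refl = inj₂ (sym (Isolated-connected (Isolated-after-removal v₁ g∈H (Joins⇒incidentʳ jg)) w~t))

  path-OtherEnd : ∀ {H a} → MaxDegree≤2 H → Degree≤1 H a → ∃[ t ] OtherEnd H a t
  path-OtherEnd {H} = go H (<-wellFounded ∣ H ∣)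
    where
    go : ∀ H → Acc _<_ ∣ H ∣ → ∀ {a} → MaxDegree≤2 H → Degree≤1 H a → ∃[ t ] OtherEnd H a t
    go H (acc smaller) {a} Δ₂ a₁ with any? (λ g → (g ∈? H) ×-dec incident? G a g)
    ... | no  ∄g = a , Isolated⇒OtherEnd (λ g∈H a∈g → ∄g (_ , g∈H , a∈g))
    ... | yes (g , g∈H , a∈g) =
      let jg = Joins-other a∈g
          t , end = go (H - g) (smaller (x∈p⇒∣p-x∣<∣p∣ g∈H)) (MaxDegree≤2-mono H-g⊆H Δ₂)
                       (Degree≤1-after-removal Δ₂ g∈H (Joins⇒incidentʳ jg))
      in t , OtherEnd-extend a₁ g∈H jg end

  -- A component containing a vertex of degree ≤ 1 is a path, so it has at most two such vertices.
  path-not-both-connected : ∀ {H a u v} → MaxDegree≤2 H → Degree≤1 H a → Degree≤1 H u → Degree≤1 H v →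
                            u ≢ a → v ≢ a → u ≢ v → ¬ Connected H a u ⊎ ¬ Connected H a v
  path-not-both-connected {u = u} {v} Δ₂ a₁ u₁ v₁ u≢a v≢a u≢v with path-OtherEnd Δ₂ a₁
  ... | t , _ , ends with u ≟ᶠ t
  ...   | yes refl = inj₂ λ a~v → [ v≢a , u≢v ∘ sym ] (ends a~v v₁)
  ...   | no  u≢t  = inj₁ λ a~u → [ u≢a , u≢t ] (ends a~u u₁)

  twoColoured : Coloring G → ℕ → ℕ → Subset (E G)
  twoColoured φ α β = tabulate (λ g → isAB (φ g) α β)

  module _ {φ : Coloring G} (proper : Proper G φ) where

    same-colour⇒≡ : ∀ {v g h c} → Incident G v g → Incident G v h → φ g ≡ just c → φ h ≡ just c → g ≡ h
    same-colour⇒≡ {v} {g} {h} {c} v∈g v∈h φg φh with g ≟ᶠ h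
    ... | yes g≡h = g≡h
    ... | no  g≢h = ⊥-elim (proper g h v c g≢h v∈g v∈h φg φh)

  module TwoColoured (φ : Coloring G) (α β : ℕ) where

    H : Subset (E G)
    H = twoColoured φ α β

    ColAB⇒∈ : ∀ {g} → ColAB G φ α β g → g ∈ H
    ColAB⇒∈ {g} p = lookup⇒[]= g _ (trans (lookup∘tabulate _ g) p)

    ∈⇒ColAB : ∀ {g} → g ∈ H → ColAB G φ α β g
    ∈⇒ColAB {g} g∈ = trans (sym (lookup∘tabulate _ g)) ([]=⇒lookup g∈)

    ∈⇒≡α⊎≡β : ∀ {g} → g ∈ H → φ g ≡ just α ⊎ φ g ≡ just β
    ∈⇒≡α⊎≡β = isAB⇒≡α⊎≡β ∘ ∈⇒ColAB

    Related⇒Connected : ∀ {ψ u v} → (∀ g → isAB (ψ g) α β ≡ isAB (φ g) α β) →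
                        Related G ψ α β u v → Connected H u v
    Related⇒Connected same here                = here
    Related⇒Connected same (step g u~w col j) =
      step (Related⇒Connected same u~w) (ColAB⇒∈ (trans (sym (same g)) col)) j

    Degree≤1⇒degAB<2 : ∀ {v} → Degree≤1 H v → degAB G φ α β v < 2
    Degree≤1⇒degAB<2 {v} v₁ =
      Unique⇒length<2 edges-at-v
        (Unique.filter⁺ at-v? (Unique.filter⁺ coloured? (Unique.allFin⁺ (E G))))
        (All.zip (All.filter⁺ at-v? (All.all-filter coloured? (allFin (E G))) , All.all-filter at-v? coloured))
        λ (col-g , v∈g) (col-h , v∈h) → v₁ (ColAB⇒∈ col-g) (ColAB⇒∈ col-h) v∈g v∈h
      where
      coloured? = λ g → isAB (φ g) α β Bool.≟ true
      at-v? = incident? G v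
      coloured = filter coloured? (allFin (E G))
      edges-at-v = filter at-v? coloured

    SuccessfulEdge-intro : ∀ {e a b} → Joins G e a b → φ e ≡ nothing → Degree≤1 H a → Degree≤1 H b →
                           ¬ Connected H a b → SuccessfulEdge G φ α β e
    SuccessfulEdge-intro je φe≡ a₁ b₁ a≁b =
      let p₁ , p₂ , p≁q = onEnds separated-sym je (a₁ , b₁ , a≁b)
      in φe≡ , Degree≤1⇒degAB<2 p₁ , Degree≤1⇒degAB<2 p₂ , p≁q ∘ Related⇒Connected (λ _ → refl)
      where
      Separated : Vtx G → Vtx G → Set
      Separated a b = Degree≤1 H a × Degree≤1 H b × ¬ Connected H a b
      separated-sym : Symmetric Separated
      separated-sym (a₁ , b₁ , a≁b) = b₁ , a₁ , a≁b ∘ Connected-sym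

    module _ (proper : Proper G φ) where

      MaxDegree≤2-H : MaxDegree≤2 H
      MaxDegree≤2-H g∈ h∈ k∈ v∈g v∈h v∈k with ∈⇒≡α⊎≡β g∈ | ∈⇒≡α⊎≡β h∈ | ∈⇒≡α⊎≡β k∈
      ... | inj₁ φg | inj₁ φh | _       = inj₁ (same-colour⇒≡ proper v∈g v∈h φg φh)
      ... | inj₂ φg | inj₂ φh | _       = inj₁ (same-colour⇒≡ proper v∈g v∈h φg φh)
      ... | inj₁ φg | inj₂ _  | inj₁ φk = inj₂ (inj₁ (same-colour⇒≡ proper v∈g v∈k φg φk))
      ... | inj₂ φg | inj₁ _  | inj₂ φk = inj₂ (inj₁ (same-colour⇒≡ proper v∈g v∈k φg φk))
      ... | inj₁ _  | inj₂ φh | inj₂ φk = inj₂ (inj₂ (same-colour⇒≡ proper v∈h v∈k φh φk))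
      ... | inj₂ _  | inj₁ φh | inj₁ φk = inj₂ (inj₂ (same-colour⇒≡ proper v∈h v∈k φh φk))

      monochromatic⇒Degree≤1 : ∀ {v c} → (∀ {g} → g ∈ H → Incident G v g → φ g ≡ just c) → Degree≤1 H v
      monochromatic⇒Degree≤1 mono g∈ h∈ v∈g v∈h = same-colour⇒≡ proper v∈g v∈h (mono g∈ v∈g) (mono h∈ v∈h)

      module _ {r : ℕ} {v : Vtx G} where

        missing-α⇒Degree≤1 : Missing G r φ v α → Degree≤1 H v
        missing-α⇒Degree≤1 (_ , α∉v) =
          monochromatic⇒Degree≤1 λ g∈ v∈g → [ ⊥-elim ∘ α∉v _ v∈g , id ] (∈⇒≡α⊎≡β g∈)

        missing-β⇒Degree≤1 : Missing G r φ v β → Degree≤1 H v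
        missing-β⇒Degree≤1 (_ , β∉v) =
          monochromatic⇒Degree≤1 λ g∈ v∈g → [ id , ⊥-elim ∘ β∉v _ v∈g ] (∈⇒≡α⊎≡β g∈)

  Avoids : Coloring G → ℕ → ℕ → List⁺ (Edge G) → Set
  Avoids φ α β F = All (λ g → φ g ≢ just α × φ g ≢ just β) (toList F)

  Outcome : ℕ → Coloring G → Edge G → Vtx G → List⁺ (Edge G) → ℕ → ℕ → Set
  Outcome r φ e x F α β = (Missing G r φ x β × Happy G r φ F)
                        ⊎ (length F ≡ 2 × SuccessfulFan G r φ α β x F)
                        ⊎ SuccessfulEdge G φ α β e

  uncoloured-avoids : ∀ (φ : Coloring G) {e α β} → φ e ≡ nothing → φ e ≢ just α × φ e ≢ just β
  uncoloured-avoids φ {e} φe≡ = uncoloured , uncoloured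
    where
    uncoloured : ∀ {c} → φ e ≢ just c
    uncoloured φe = case trans (sym φe≡) φe of λ ()

  CommonMissing : ℕ → Coloring G → ℕ → Vtx G → Vtx G → Set
  CommonMissing r φ c a b = Missing G r φ a c × Missing G r φ b c

  CommonMissing-sym : ∀ r φ c → Symmetric (CommonMissing r φ c)
  CommonMissing-sym r φ c = swap

  module _ {φ ψ : Coloring G} where

    Proper-fewer-colours : (∀ {g c} → ψ g ≡ just c → φ g ≡ just c) → Proper G φ → Proper G ψ
    Proper-fewer-colours ψ⊑φ proper g h v c g≢h v∈g v∈h ψg ψh =
      proper g h v c g≢h v∈g v∈h (ψ⊑φ ψg) (ψ⊑φ ψh)

    Missing-transfer : ∀ {r v c} → (∀ {g} → ψ g ≡ just c → φ g ≡ just c) →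
                       Missing G r φ v c → Missing G r ψ v c
    Missing-transfer ψ⊑φ (c∈[r] , c∉v) = c∈[r] , λ g v∈g ψg → c∉v g v∈g (ψ⊑φ ψg)

  module _ {r : ℕ} {φ : Coloring G} (proper : Proper G φ) {e : Edge G} (φe≡ : φ e ≡ nothing) where

    Shift-uncoloured : ∀ g → Shift G φ (e ∷ []) g ≡ φ g
    Shift-uncoloured g with g ≟ᶠ e
    ... | yes refl = sym φe≡
    ... | no _     = refl

    single-edge-outcome : ∀ {x y β} → Joins G e x y → Missing G r φ x β → Missing G r φ y β →
                          Avoids φ β β (e ∷ []) × Outcome r φ e x (e ∷ []) β β
    single-edge-outcome {β = β} je β∉x β∉y =
      uncoloured-avoids φ φe≡ ∷ [] ,
      inj₁ (β∉x , shiftable , trans (Shift-uncoloured e) φe≡ ,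
            β , onEnds (CommonMissing-sym r _ β) je (unshift β∉x , unshift β∉y))
      where
      unshift-colour : ∀ {g c} → Shift G φ (e ∷ []) g ≡ just c → φ g ≡ just c
      unshift-colour {g} = trans (sym (Shift-uncoloured g))
      unshift : ∀ {v} → Missing G r φ v β → Missing G r (Shift G φ (e ∷ [])) v β
      unshift = Missing-transfer unshift-colour
      shiftable : Shiftable G φ (e ∷ [])
      shiftable = ([] ∷ [] , tt) , φe≡ , Proper-fewer-colours unshift-colour proper

  module _ {r : ℕ} {φ : Coloring G} (proper : Proper G φ) {e f x y z η}
           (je : Joins G e x y) (jf : Joins G f x z) (φe≡ : φ e ≡ nothing) (φf≡ : φ f ≡ just η)
           (η∉y : Missing G r φ y η) where

    F : List⁺ (Edge G)
    F = e ∷ f ∷ []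

    ψ : Coloring G
    ψ = Shift G φ F

    e≢f : e ≢ f
    e≢f refl = case trans (sym φe≡) φf≡ of λ ()

    y≢z : y ≢ z
    y≢z refl = proj₂ η∉y f (Joins⇒incidentʳ jf) φf≡

    ψe≡ : ψ e ≡ just η
    ψe≡ with e ≟ᶠ e
    ... | yes _   = φf≡
    ... | no e≢e = ⊥-elim (e≢e refl)

    ψf≡ : ψ f ≡ nothing
    ψf≡ with f ≟ᶠ e | f ≟ᶠ f
    ... | yes f≡e | _       = ⊥-elim (e≢f (sym f≡e))
    ... | no _    | yes _   = refl
    ... | no _    | no f≢f = ⊥-elim (f≢f refl)

    ψ-coloured : ∀ {g c} → ψ g ≡ just c → (g ≡ e × c ≡ η) ⊎ (g ≢ f × φ g ≡ just c)
    ψ-coloured {g} ψg with g ≟ᶠ e | g ≟ᶠ f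
    ... | yes refl | _        = inj₁ (refl , just-injective (trans (sym ψg) φf≡))
    ... | no _     | yes refl = case ψg of λ ()
    ... | no _     | no g≢f   = inj₂ (g≢f , ψg)

    φ-coloured : ∀ {g c} → φ g ≡ just c → c ≢ η → ψ g ≡ just c
    φ-coloured {g} φg c≢η with g ≟ᶠ e | g ≟ᶠ f
    ... | yes refl | _        = case trans (sym φg) φe≡ of λ ()
    ... | no _     | yes refl = ⊥-elim (c≢η (just-injective (trans (sym φg) φf≡)))
    ... | no _     | no _     = φg

    η-only-at-f-near-e : ∀ {v h} → Incident G v e → Incident G v h → h ≢ f → φ h ≢ just η
    η-only-at-f-near-e v∈e v∈h h≢f φh with Joins-incident je v∈e
    ... | inj₁ refl = h≢f (same-colour⇒≡ proper v∈h (Joins⇒incidentˡ jf) φh φf≡)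
    ... | inj₂ refl = proj₂ η∉y _ v∈h φh

    ψ-proper : Proper G ψ
    ψ-proper g h v c g≢h v∈g v∈h ψg ψh with ψ-coloured {g} ψg | ψ-coloured {h} ψh
    ... | inj₁ (refl , _)    | inj₁ (refl , _)    = g≢h refl
    ... | inj₁ (refl , refl) | inj₂ (h≢f , φh)    = η-only-at-f-near-e v∈g v∈h h≢f φh
    ... | inj₂ (g≢f , φg)    | inj₁ (refl , refl) = η-only-at-f-near-e v∈h v∈g g≢f φg
    ... | inj₂ (_ , φg)      | inj₂ (_ , φh)      = proper g h v c g≢h v∈g v∈h φg φh

    fan : Fan G x F
    fan = (((e≢f ∷ []) ∷ [] ∷ []) , shares-x , tt) , Joins⇒incidentˡ je ∷ Joins⇒incidentˡ jf ∷ []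
      where
      shares-x : ShareOne G e f
      shares-x = x , Joins⇒incidentˡ je , Joins⇒incidentˡ jf , λ w w∈e w∈f →
        case Joins-incident je w∈e , Joins-incident jf w∈f of λ where
          (inj₁ w≡x , _)         → w≡x
          (_ , inj₁ w≡x)         → w≡x
          (inj₂ w≡y , inj₂ w≡z) → ⊥-elim (y≢z (trans (sym w≡y) w≡z))

    shiftable : Shiftable G φ F
    shiftable = proj₁ fan , φe≡ , ψ-proper

    Missing-shift : ∀ {v c} → c ≢ η → Missing G r φ v c → Missing G r ψ v c
    Missing-shift c≢η = Missing-transfer λ {g} ψg → [ ⊥-elim ∘ c≢η ∘ proj₂ , proj₂ ] (ψ-coloured {g} ψg)

    Missing-unshift : ∀ {v c} → c ≢ η → Missing G r ψ v c → Missing G r φ v c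
    Missing-unshift c≢η = Missing-transfer λ {g} φg → φ-coloured {g} φg c≢η

    not-happy : (∀ c → ¬ (Missing G r φ x c × Missing G r φ z c)) → ¬ Happy G r φ F
    not-happy no-common (_ , _ , c , c∉ends) with fromEnds (CommonMissing-sym r ψ c) jf c∉ends | c ≟ⁿ η
    ... | c∉x , _   | yes refl = proj₂ c∉x e (Joins⇒incidentˡ je) ψe≡
    ... | c∉x , c∉z | no c≢η   = no-common c (Missing-unshift c≢η c∉x , Missing-unshift c≢η c∉z)

    ψ-twoColoured : ∀ {α β} → η ≢ α → η ≢ β → ∀ g → isAB (ψ g) α β ≡ isAB (φ g) α β
    ψ-twoColoured η≢α η≢β g with g ≟ᶠ e | g ≟ᶠ f
    ... | yes refl | _        rewrite φf≡ | φe≡ = isAB-≢ η≢α η≢β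
    ... | no _     | yes refl rewrite φf≡       = sym (isAB-≢ η≢α η≢β)
    ... | no _     | no _     = refl

    two-edge-happy : ∀ {β} → Missing G r φ x β → Missing G r φ z β → Avoids φ β β F × Outcome r φ e x F β β
    two-edge-happy {β} β∉x β∉z =
      uncoloured-avoids φ φe≡ ∷ (φf≢β , φf≢β) ∷ [] ,
      inj₁ (β∉x , shiftable , ψf≡ ,
            β , onEnds (CommonMissing-sym r ψ β) jf (Missing-shift β≢η β∉x , Missing-shift β≢η β∉z))
      where
      φf≢β : φ f ≢ just β
      φf≢β = proj₂ β∉x f (Joins⇒incidentˡ jf)
      β≢η : β ≢ η
      β≢η β≡η = φf≢β (trans φf≡ (cong just (sym β≡η)))

    two-edge-successful : ∀ {α β} → (∀ c → ¬ (Missing G r φ x c × Missing G r φ z c)) →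
                          Missing G r φ x α → Missing G r φ y β → Missing G r φ z β →
                          Avoids φ α β F × Outcome r φ e x F α β
    two-edge-successful {α} {β} no-common α∉x β∉y β∉z =
      uncoloured-avoids φ φe≡ ∷ (φf≢α , φf≢β) ∷ [] , successful
      where
      open TwoColoured φ α β
      φf≢α : φ f ≢ just α
      φf≢α = proj₂ α∉x f (Joins⇒incidentˡ jf)
      φf≢β : φ f ≢ just β
      φf≢β = proj₂ β∉z f (Joins⇒incidentʳ jf)
      η≢α : η ≢ α
      η≢α = φf≢α ∘ trans φf≡ ∘ cong just
      η≢β : η ≢ β
      η≢β = φf≢β ∘ trans φf≡ ∘ cong just
      x₁ : Degree≤1 H x
      x₁ = missing-α⇒Degree≤1 proper α∉x
      y₁ : Degree≤1 H y
      y₁ = missing-β⇒Degree≤1 proper β∉y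
      z₁ : Degree≤1 H z
      z₁ = missing-β⇒Degree≤1 proper β∉z
      successful : Outcome r φ e x F α β
      successful with path-not-both-connected (MaxDegree≤2-H proper) x₁ y₁ z₁
                        (Joins⇒≢ je ∘ sym) (Joins⇒≢ jf ∘ sym) y≢z
      ... | inj₁ x≁y = inj₂ (inj₂ (SuccessfulEdge-intro je φe≡ x₁ y₁ x≁y))
      ... | inj₂ x≁z rewrite other-Joins jf =
        inj₂ (inj₁ (refl , fan , shiftable , not-happy no-common , Degree≤1⇒degAB<2 x₁ , Degree≤1⇒degAB<2 z₁ ,
                    x≁z ∘ Related⇒Connected (ψ-twoColoured η≢α η≢β)))

lemma2p11 : (G : Multigraph) (Δ : ℕ) → MaxDegree G Δ → 2 ≤ Δ →
    (φ : Coloring G) → PartialColoring G (colors Δ) φ → Proper G φ →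
    (e : Edge G) → φ e ≡ nothing → (x : Vtx G) → Incident G x e →
    (F : List⁺ (Edge G)) (α β : ℕ) → FirstShannonFan G (colors Δ) φ e x F α β →
    All (λ g → φ g ≢ just α × φ g ≢ just β) (toList F) ×
    ((Missing G (colors Δ) φ x β × Happy G (colors Δ) φ F)
     ⊎ (length F ≡ 2 × SuccessfulFan G (colors Δ) φ α β x F)
     ⊎ SuccessfulEdge G φ α β e)
lemma2p11 G _ _ _ _ _ proper _ φe≡ _ _ _ _ _
  (inj₁ (_ , je , ((β∉x , β∉y) , _) , refl , refl)) =
  single-edge-outcome G proper φe≡ je β∉x β∉y
lemma2p11 G _ _ _ _ _ proper _ φe≡ _ _ _ _ _
  (inj₂ (inj₁ (_ , _ , _ , _ , je , _ , (η∉y , _) , φf≡ , jf , ((β∉x , β∉z) , _) , refl , refl))) =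
  two-edge-happy G proper je jf φe≡ φf≡ η∉y β∉x β∉z
lemma2p11 G _ _ _ _ _ proper _ φe≡ _ _ _ _ _
  (inj₂ (inj₂ (_ , _ , _ , _ , je , _ , (η∉y , _) , φf≡ , jf ,
               no-common , ((β∉y , β∉z) , _) , (α∉x , _) , refl))) =
  two-edge-successful G proper je jf φe≡ φf≡ η∉y no-common α∉x β∉y β∉z
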